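{- Let $n$ be a positive integer and let $w_1 \leq \dots \leq w_m$ be a feasible partition of $n$. Then for every $i$ with $1 \leq i \leq m$, $w_i \leq \frac{2R_i + 1}{3}$.
   Context: A feasible partition of a positive integer $n$ is a nondecreasing sequence of positive integers $w_1 \leq \dots \leq w_m$ with $w_1 + \dots + w_m = n$ such that (i) every integer $k$ with $1 \leq k \leq n$ can be written as $k = \sum_{i=1}^m u_i w_i$ with each $u_i \in \{ -1,0,1\}$, and (ii) $m$ is the minimum possible number of parts among all sequences of positive integers summing to $n$ with property (i). For such a partition, $R_i = w_1 + \dots + w_i$ for $1 \leq i \leq m$, and $R_0 = 0$. -}

module Defs where

open import Data.Nat using (ℕ; zero; suc; _+_; _*_; _≤_; _<_)
open import Data.Integer as ℤ using (ℤ; +_)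
open import Data.List using (List; []; _∷_; length; take)
open import Data.Nat.ListAction using (sum)
open import Data.List.Relation.Unary.All using (All)
open import Data.Nat.Properties using (≤-totalOrder)
open import Data.List.Relation.Unary.Sorted.TotalOrder ≤-totalOrder using (Sorted)
open import Data.Product using (Σ; ∃; _×_)
open import Relation.Binary.PropositionalEquality using (_≡_)

data Sign : Set where
  neg zer pos : Sign

signed : Sign → ℕ → ℤ
signed neg w = ℤ.- (+ w)
signed zer w = + 0
signed pos w = + w

data Signs : List ℕ → Set where
  []  : Signs []
  _∷_ : ∀ {w ws} → Sign → Signs ws → Signs (w ∷ ws)

signedSum : (ws : List ℕ) → Signs ws → ℤ
signedSum [] [] = + 0
signedSum (w ∷ ws) (u ∷ us) = signed u w ℤ.+ signedSum ws us

Representable : List ℕ → ℕ → Set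
Representable ws k = Σ (Signs ws) λ us → signedSum ws us ≡ + k

CoversUpTo : ℕ → List ℕ → Set
CoversUpTo n ws = ∀ k → 1 ≤ k → k ≤ n → Representable ws k

Admissible : ℕ → List ℕ → Set
Admissible n ws = All (λ w → 1 ≤ w) ws × sum ws ≡ n × CoversUpTo n ws

Feasible : ℕ → List ℕ → Set
Feasible n ws =
  Sorted ws × Admissible n ws ×
  (∀ vs → Admissible n vs → length ws ≤ length vs)

R : List ℕ → ℕ → ℕ
R ws i = sum (take i ws)

-- w_i with 1-based indexing (meaningful for 1 ≤ i ≤ length ws)
w : List ℕ → ℕ → ℕ
w [] i = 0
w (x ∷ xs) zero = 0
w (x ∷ xs) (suc zero) = x
w (x ∷ xs) (suc (suc i)) = w xs (suc i)

-- Write a signed sum Σ uᵢwᵢ as Σ wᵢ minus the deficit Σ (1 − uᵢ)wᵢ, a sum of terms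
-- 0, wᵢ or 2wᵢ. If the part w_{j+1} exceeded D = 2R_j + 1 then, the partition being
-- sorted, every part from position j+1 on would exceed D; a deficit is then either at
-- most 2R_j (only the first j parts contribute) or larger than D, never equal to D.
-- So n − D, which must be representable, is not, and w_{j+1} ≤ 2R_j + 1 follows,
-- which rearranges to 3w_{j+1} ≤ 2R_{j+1} + 1.
module Submission where

open import Defs
open import Data.Nat using (ℕ; zero; suc; _+_; _*_; _∸_; _≤_; _<_; z≤n; s≤s)
open import Data.Nat.Properties
open import Data.Nat.ListAction using (sum)
open import Data.Integer as ℤ using (ℤ; +_)
open import Data.Integer.Properties as ℤ using (+-injective)
open import Algebra.Properties.CommutativeSemigroup ℤ.+-commutativeSemigroup using (interchange)
open import Data.Integer.Tactic.RingSolver using (solve-∀)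
import Data.Nat.Tactic.RingSolver as ℕ
open import Data.List using (List; []; _∷_; length; drop)
open import Data.List.Relation.Unary.All as All using (All; _∷_)
import Data.List.Relation.Unary.Linked as Linked
open import Data.List.Relation.Unary.Linked.Properties using (Linked⇒All)
open import Data.List.Relation.Unary.Sorted.TotalOrder ≤-totalOrder using (Sorted)
open import Data.Product using (_,_)
open import Data.Sum using (_⊎_; inj₁; inj₂)
open import Data.Empty using (⊥)
open import Relation.Binary.PropositionalEquality
open import Relation.Nullary using (¬_; yes; no; contradiction)

R-suc : ∀ ws j → R ws (suc j) ≡ R ws j + w ws (suc j)
R-suc []       zero    = refl
R-suc []       (suc j) = refl
R-suc (x ∷ ws) zero    = +-comm x 0
R-suc (x ∷ ws) (suc j) = trans (cong (λ r → x + r) (R-suc ws j)) (sym (+-assoc x _ _))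

R≤sum : ∀ ws j → R ws j ≤ sum ws
R≤sum ws       zero    = z≤n
R≤sum []       (suc j) = z≤n
R≤sum (x ∷ ws) (suc j) = +-monoʳ-≤ x (R≤sum ws j)

sorted⇒w≤drop : ∀ {ws} → Sorted ws → ∀ j → suc j ≤ length ws →
                All (w ws (suc j) ≤_) (drop j ws)
sorted⇒w≤drop {x ∷ ws} s zero    _         = Linked⇒All ≤-trans ≤-refl s
sorted⇒w≤drop {x ∷ ws} s (suc j) (s≤s j<) = sorted⇒w≤drop (Linked.tail s) j j<

deficit : Sign → ℕ → ℕ
deficit neg x = x + x
deficit zer x = x
deficit pos x = 0

deficitSum : (ws : List ℕ) → Signs ws → ℕ
deficitSum []       []       = 0
deficitSum (x ∷ ws) (u ∷ us) = deficit u x + deficitSum ws us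

signed+deficit : ∀ u x → signed u x ℤ.+ + deficit u x ≡ + x
signed+deficit neg x = -a+[a+a]≡a (+ x)
  where -a+[a+a]≡a : ∀ (a : ℤ) → ℤ.- a ℤ.+ (a ℤ.+ a) ≡ a
        -a+[a+a]≡a = solve-∀
signed+deficit zer x = ℤ.+-identityˡ (+ x)
signed+deficit pos x = ℤ.+-identityʳ (+ x)

signedSum+deficitSum : ∀ ws us → signedSum ws us ℤ.+ + deficitSum ws us ≡ + sum ws
signedSum+deficitSum []       []       = refl
signedSum+deficitSum (x ∷ ws) (u ∷ us) = begin
  (signed u x ℤ.+ signedSum ws us) ℤ.+ (+ deficit u x ℤ.+ + deficitSum ws us)
    ≡⟨ interchange (signed u x) (signedSum ws us) (+ deficit u x) (+ deficitSum ws us) ⟩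
  (signed u x ℤ.+ + deficit u x) ℤ.+ (signedSum ws us ℤ.+ + deficitSum ws us)
    ≡⟨ cong₂ ℤ._+_ (signed+deficit u x) (signedSum+deficitSum ws us) ⟩
  + x ℤ.+ + sum ws ∎
  where open ≡-Reasoning

representation⇒deficitSum : ∀ {ws k} us → signedSum ws us ≡ + k → k + deficitSum ws us ≡ sum ws
representation⇒deficitSum {ws} us eq =
  +-injective (trans (cong (ℤ._+ + deficitSum ws us) (sym eq)) (signedSum+deficitSum ws us))

deficit≤2* : ∀ u x → deficit u x ≤ 2 * x
deficit≤2* neg x = ≤-reflexive (cong (λ r → x + r) (sym (+-identityʳ x)))
deficit≤2* zer x = m≤m+n x (x + 0)
deficit≤2* pos x = z≤n

deficitSum≡0⊎≥ : ∀ {L} ws us → All (L ≤_) ws → deficitSum ws us ≡ 0 ⊎ L ≤ deficitSum ws us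
deficitSum≡0⊎≥ []       []         _          = inj₁ refl
deficitSum≡0⊎≥ (x ∷ ws) (pos ∷ us) (_ ∷ L≤)   = deficitSum≡0⊎≥ ws us L≤
deficitSum≡0⊎≥ (x ∷ ws) (neg ∷ us) (L≤x ∷ _) =
  inj₂ (≤-trans L≤x (≤-trans (m≤m+n x x) (m≤m+n (x + x) _)))
deficitSum≡0⊎≥ (x ∷ ws) (zer ∷ us) (L≤x ∷ _) = inj₂ (≤-trans L≤x (m≤m+n x _))

deficitSum-gap : ∀ {L} ws us j → All (L ≤_) (drop j ws) →
                 deficitSum ws us ≤ 2 * R ws j ⊎ L ≤ deficitSum ws us
deficitSum-gap ws us zero L≤ with deficitSum≡0⊎≥ ws us L≤
... | inj₁ d≡0 = inj₁ (≤-reflexive d≡0)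
... | inj₂ L≤d = inj₂ L≤d
deficitSum-gap []       []       (suc j) _  = inj₁ z≤n
deficitSum-gap (x ∷ ws) (u ∷ us) (suc j) L≤ with deficitSum-gap ws us j L≤
... | inj₁ d≤ = inj₁ (≤-trans (+-mono-≤ (deficit≤2* u x) d≤)
                              (≤-reflexive (sym (*-distribˡ-+ 2 x (R ws j)))))
... | inj₂ L≤d = inj₂ (≤-trans L≤d (m≤n+m _ (deficit u x)))

gap⇒¬representable : ∀ ws j {k} → All (2 * R ws j + 1 <_) (drop j ws) →
                     k + (2 * R ws j + 1) ≡ sum ws → ¬ Representable ws k
gap⇒¬representable ws j {k} D<later k+D≡sum (us , eq) =
  missesD (deficitSum-gap ws us j D<later)
  where
  d≡D : deficitSum ws us ≡ 2 * R ws j + 1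
  d≡D = +-cancelˡ-≡ k _ _ (trans (representation⇒deficitSum us eq) (sym k+D≡sum))
  missesD : deficitSum ws us ≤ 2 * R ws j ⊎ 2 * R ws j + 1 < deficitSum ws us → ⊥
  missesD (inj₁ d≤2R) = 1+n≰n (subst (_≤ 2 * R ws j) (trans d≡D (+-comm _ 1)) d≤2R)
  missesD (inj₂ D<d)  = n≮n _ (subst (2 * R ws j + 1 <_) d≡D D<d)

part≤2*R+1 : ∀ ws → Sorted ws → CoversUpTo (sum ws) ws →
             ∀ j → suc j ≤ length ws → w ws (suc j) ≤ 2 * R ws j + 1
part≤2*R+1 ws sorted covers j j< with w ws (suc j) ≤? 2 * R ws j + 1
... | yes x≤D = x≤D
... | no  x≰D =
  contradiction (covers (sum ws ∸ D) (m<n⇒0<n∸m D<sum) (m∸n≤m (sum ws) D))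
    (gap⇒¬representable ws j (All.map (<-≤-trans D<x) (sorted⇒w≤drop sorted j j<))
                             (m∸n+n≡m (<⇒≤ D<sum)))
  where
  D = 2 * R ws j + 1
  D<x : D < w ws (suc j)
  D<x = ≰⇒> x≰D
  D<sum : D < sum ws
  D<sum = <-≤-trans D<x (begin
    w ws (suc j)            ≤⟨ m≤n+m _ (R ws j) ⟩
    R ws j + w ws (suc j)   ≡⟨ R-suc ws j ⟨
    R ws (suc j)            ≤⟨ R≤sum ws (suc j) ⟩
    sum ws                  ∎)
    where open ≤-Reasoning

x≤2S+1⇒3x≤2[S+x]+1 : ∀ S {x} → x ≤ 2 * S + 1 → 3 * x ≤ 2 * (S + x) + 1
x≤2S+1⇒3x≤2[S+x]+1 S {x} x≤ = begin
  3 * x               ≡⟨⟩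
  x + 2 * x           ≤⟨ +-monoˡ-≤ (2 * x) x≤ ⟩
  2 * S + 1 + 2 * x   ≡⟨ regroup S x ⟩
  2 * (S + x) + 1     ∎
  where
  open ≤-Reasoning
  regroup : ∀ S x → 2 * S + 1 + 2 * x ≡ 2 * (S + x) + 1
  regroup = ℕ.solve-∀

mainTheorem4 : (n : ℕ) → 1 ≤ n → (ws : List ℕ) → Feasible n ws →
    (i : ℕ) → 1 ≤ i → i ≤ length ws → 3 * w ws i ≤ 2 * R ws i + 1
mainTheorem4 n _ ws (sorted , (_ , sum≡n , covers) , _) (suc j) _ j<
  rewrite R-suc ws j =
  x≤2S+1⇒3x≤2[S+x]+1 (R ws j) (part≤2*R+1 ws sorted covers′ j j<)
  where
  covers′ : CoversUpTo (sum ws) ws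
  covers′ = subst (λ m → CoversUpTo m ws) (sym sum≡n) covers
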